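{- Let $M\models T_{\mathrm{MSO(Fin)}}$ and suppose $M\approx_k\mathrm{MSO}(n)$ for some $k,n\in\mathbb{N}$. Then $M\oplus\mathrm{MSO}(1)\approx_k\mathrm{MSO}(n+1)$.
   Context: $\mathbb{N}=\{0,1,2,\dots\}$. Let $\mathcal{L}=\{\subseteq,\bot,\mathrm{At},\lhd\}$ be the first-order language with binary relation symbols $\subseteq,\lhd$, a constant $\bot$ and a unary relation symbol $\mathrm{At}$. For a linear order $(\alpha,<)$, $\mathrm{MSO}(\alpha)$ is the $\mathcal{L}$-structure with universe $\mathcal{P}(\alpha)$, $\subseteq$ inclusion, $\bot=\emptyset$, $\mathrm{At}$ the singletons, $A\lhd B$ iff some $a\in A$, $b\in B$ have $a<b$; $\mathrm{MSO}(n)$ is this for the $n$-element order. Lowercase variables range over atoms; $X(x)$ abbreviates $x\subseteq X$. $T_{\mathrm{base}}$ states: $\subseteq$ is an atomic Boolean algebra order (one-element algebra allowed); $\lhd$ linearly orders the atoms; $\bot$ is least; $\mathrm{At}$ holds exactly of atoms; $\forall X\forall Y(X\lhd Y\leftrightarrow\exists x\exists y(X(x)\wedge Y(y)\wedge x\lhd y))$; and for every $\mathcal{L}$-formula $\eta(x;\bar Y)$, $\forall\bar Y\exists X\forall x(X(x)\leftrightarrow\eta(x;\bar Y))$. $T_{\mathrm{MSO(Fin)}}$ is $T_{\mathrm{base}}$ plus: the order on atoms is discrete with endpoints, and every $X\neq\bot$ contains a $\lhd$-least atom. For $M,N\models T_{\mathrm{base}}$, $M\oplus N$ has universe $|M|\times|N|$,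 $\subseteq$ componentwise, $\bot$ and $\mathrm{At}$ the bottom and atoms of the product Boolean algebra, and $(A,B)\lhd(C,D)$ iff ($A\neq\bot$ and $D\neq\bot$) or $M\models A\lhd C$ or $N\models B\lhd D$. $M\approx_k N$ means $M,N$ satisfy the same unnested $\mathcal{L}$-sentences of quantifier rank at most $k$ (unnested: all atomic subformulas are $x=y$, $x=\bot$, $\mathrm{At}(x)$, $x\subseteq y$, $x\lhd y$ with $x,y$ variables), equivalently player II wins the $k$-round unnested Ehrenfeucht–Fraïssé game on $M,N$. -}

module Defs where

open import Level using (0ℓ)
open import Data.Nat using (ℕ; zero; suc; _≤_)
open import Data.Fin using (Fin; zero; suc; _<_)
open import Data.Fin.Subset as Sub using (Subset; _∈_; ⁅_⁆)
open import Data.Product using (Σ; ∃; ∃-syntax; _×_; _,_)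
open import Data.Sum using (_⊎_)
open import Data.Unit using (⊤)
open import Data.Empty using (⊥)
open import Relation.Nullary using (¬_)
open import Relation.Binary.PropositionalEquality using (_≡_; _≢_)
open import Relation.Binary.Lattice.Structures using (IsBooleanAlgebra)

-- L-structures, L = {⊆, ⊥, At, ◁}.  Equality is interpreted as _≡_.

record Structure : Set₁ where
  field
    Carrier : Set
    _⊑_     : Carrier → Carrier → Set
    bot     : Carrier
    At      : Carrier → Set
    _◁_     : Carrier → Carrier → Set


-- First-order L-formulas (de Bruijn variables; Formula n has n free vars)

data Term (n : ℕ) : Set where
  var  : Fin n → Term n
  botₜ : Term n

data Formula (n : ℕ) : Set where
  _≐_   : Term n → Term n → Formula n
  _⊆ᶠ_  : Term n → Term n → Formula n
  _◁ᶠ_  : Term n → Term n → Formula n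
  Atᶠ   : Term n → Formula n
  ⊤ᶠ ⊥ᶠ : Formula n
  ¬ᶠ_   : Formula n → Formula n
  _∧ᶠ_ _∨ᶠ_ _⇒ᶠ_ : Formula n → Formula n → Formula n
  ∀ᶠ ∃ᶠ : Formula (suc n) → Formula n

Sentence : Set
Sentence = Formula 0

qr : ∀ {n} → Formula n → ℕ
qr (_ ≐ _) = 0
qr (_ ⊆ᶠ _) = 0
qr (_ ◁ᶠ _) = 0
qr (Atᶠ _) = 0
qr ⊤ᶠ = 0
qr ⊥ᶠ = 0
qr (¬ᶠ φ) = qr φ
qr (φ ∧ᶠ ψ) = qr φ Data.Nat.⊔ qr ψ
qr (φ ∨ᶠ ψ) = qr φ Data.Nat.⊔ qr ψ
qr (φ ⇒ᶠ ψ) = qr φ Data.Nat.⊔ qr ψ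
qr (∀ᶠ φ) = suc (qr φ)
qr (∃ᶠ φ) = suc (qr φ)

data Unnested {n : ℕ} : Formula n → Set where
  u-eq   : ∀ i j → Unnested (var i ≐ var j)
  u-eqbot : ∀ i → Unnested (var i ≐ botₜ)
  u-at   : ∀ i → Unnested (Atᶠ (var i))
  u-sub  : ∀ i j → Unnested (var i ⊆ᶠ var j)
  u-lt   : ∀ i j → Unnested (var i ◁ᶠ var j)
  u-⊤    : Unnested ⊤ᶠ
  u-⊥    : Unnested ⊥ᶠ
  u-¬    : ∀ {φ} → Unnested φ → Unnested (¬ᶠ φ)
  u-∧    : ∀ {φ ψ} → Unnested φ → Unnested ψ → Unnested (φ ∧ᶠ ψ)
  u-∨    : ∀ {φ ψ} → Unnested φ → Unnested ψ → Unnested (φ ∨ᶠ ψ)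
  u-⇒    : ∀ {φ ψ} → Unnested φ → Unnested ψ → Unnested (φ ⇒ᶠ ψ)
  u-∀    : ∀ {φ} → Unnested φ → Unnested (∀ᶠ φ)
  u-∃    : ∀ {φ} → Unnested φ → Unnested (∃ᶠ φ)

_∷ₑ_ : ∀ {A : Set} {n} → A → (Fin n → A) → Fin (suc n) → A
(a ∷ₑ ρ) zero = a
(a ∷ₑ ρ) (suc i) = ρ i

-- satisfaction (the theorem assumes excluded middle, so this is classical)
module _ (M : Structure) where
  open Structure M renaming (Carrier to C)

  ⟦_⟧ₜ : ∀ {n} → Term n → (Fin n → C) → C
  ⟦ var i ⟧ₜ ρ = ρ i
  ⟦ botₜ ⟧ₜ ρ = bot

  Sat : ∀ {n} → Formula n → (Fin n → C) → Set
  Sat (s ≐ t) ρ = ⟦ s ⟧ₜ ρ ≡ ⟦ t ⟧ₜ ρ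
  Sat (s ⊆ᶠ t) ρ = ⟦ s ⟧ₜ ρ ⊑ ⟦ t ⟧ₜ ρ
  Sat (s ◁ᶠ t) ρ = ⟦ s ⟧ₜ ρ ◁ ⟦ t ⟧ₜ ρ
  Sat (Atᶠ t) ρ = At (⟦ t ⟧ₜ ρ)
  Sat ⊤ᶠ ρ = ⊤
  Sat ⊥ᶠ ρ = ⊥
  Sat (¬ᶠ φ) ρ = ¬ Sat φ ρ
  Sat (φ ∧ᶠ ψ) ρ = Sat φ ρ × Sat ψ ρ
  Sat (φ ∨ᶠ ψ) ρ = Sat φ ρ ⊎ Sat ψ ρ
  Sat (φ ⇒ᶠ ψ) ρ = Sat φ ρ → Sat ψ ρ
  Sat (∀ᶠ φ) ρ = (a : C) → Sat φ (a ∷ₑ ρ)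
  Sat (∃ᶠ φ) ρ = Σ C λ a → Sat φ (a ∷ₑ ρ)

empty : ∀ {A : Set} → Fin 0 → A
empty ()

_⊨_ : Structure → Sentence → Set
M ⊨ φ = Sat M φ empty

_≈[_]_ : Structure → ℕ → Structure → Set
M ≈[ k ] N = (φ : Sentence) → Unnested φ → qr φ ≤ k →
             (M ⊨ φ → N ⊨ φ) × (N ⊨ φ → M ⊨ φ)

IsAtom : {A : Set} → (A → A → Set) → A → A → Set
IsAtom _≤_ b x = x ≢ b × (∀ y → y ≤ x → y ≡ b ⊎ y ≡ x)

record ModelsTbase (M : Structure) : Set where
  open Structure M renaming (Carrier to C; bot to ⊥M)
  field
    -- ⊆ is a Boolean algebra order with least element ⊥ (one-element allowed)
    booleanOrder : Σ (C → C → C) λ _∨_ → Σ (C → C → C) λ _∧_ →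
                   Σ (C → C) λ ¬′ → Σ C λ ⊤M →
                   IsBooleanAlgebra _≡_ _⊑_ _∨_ _∧_ ¬′ ⊤M ⊥M
    atomic  : ∀ X → X ≢ ⊥M → Σ C λ x → At x × x ⊑ X
    botLeast : ∀ X → ⊥M ⊑ X
    atAtoms : ∀ x → (At x → IsAtom _⊑_ ⊥M x) × (IsAtom _⊑_ ⊥M x → At x)
    ◁-irrefl : ∀ x → At x → ¬ (x ◁ x)
    ◁-trans  : ∀ x y z → At x → At y → At z → x ◁ y → y ◁ z → x ◁ z
    ◁-total  : ∀ x y → At x → At y → x ◁ y ⊎ x ≡ y ⊎ y ◁ x
    ◁-sets   : ∀ X Y → (X ◁ Y → Σ C λ x → Σ C λ y → At x × At y × x ⊑ X × y ⊑ Y × x ◁ y)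
                     × ((Σ C λ x → Σ C λ y → At x × At y × x ⊑ X × y ⊑ Y × x ◁ y) → X ◁ Y)
    -- comprehension schema: for every L-formula η(x; Y₁..Yₘ)
    -- (variable 0 is the atom x, variables 1..m are the parameters Ȳ)
    comprehension : ∀ {m} (η : Formula (suc m)) (Ys : Fin m → C) →
                    Σ C λ X → ∀ x → At x →
                      (x ⊑ X → Sat M η (x ∷ₑ Ys)) × (Sat M η (x ∷ₑ Ys) → x ⊑ X)

record ModelsTMSOFin (M : Structure) : Set where
  open Structure M renaming (Carrier to C; bot to ⊥M)
  field
    base : ModelsTbase M
    leastAtom    : ∀ x → At x → Σ C λ a → At a × (∀ y → At y → a ≡ y ⊎ a ◁ y)
    greatestAtom : ∀ x → At x → Σ C λ b → At b × (∀ y → At y → y ≡ b ⊎ y ◁ b)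
    successor   : ∀ x → At x → (Σ C λ y → At y × x ◁ y) →
                  Σ C λ s → At s × x ◁ s × (∀ y → At y → x ◁ y → s ≡ y ⊎ s ◁ y)
    predecessor : ∀ x → At x → (Σ C λ y → At y × y ◁ x) →
                  Σ C λ p → At p × p ◁ x × (∀ y → At y → y ◁ x → y ≡ p ⊎ y ◁ p)
    leastInSet  : ∀ X → X ≢ ⊥M →
                  Σ C λ x → At x × x ⊑ X × (∀ y → At y → y ⊑ X → x ≡ y ⊎ x ◁ y)

MSO : ℕ → Structure
MSO n = record
  { Carrier = Subset n
  ; _⊑_ = Sub._⊆_
  ; bot = Sub.⊥
  ; At = λ A → Σ (Fin n) λ i → A ≡ ⁅ i ⁆
  ; _◁_ = λ A B → Σ (Fin n) λ i → Σ (Fin n) λ j → i ∈ A × j ∈ B × i < j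
  }

_⊕_ : Structure → Structure → Structure
M ⊕ N = record
  { Carrier = Structure.Carrier M × Structure.Carrier N
  ; _⊑_ = ⊑⊕
  ; bot = (Structure.bot M , Structure.bot N)
  ; At = IsAtom ⊑⊕ (Structure.bot M , Structure.bot N)
  ; _◁_ = λ { (A , B) (C , D) → (A ≢ Structure.bot M × D ≢ Structure.bot N) ⊎ Structure._◁_ M A C ⊎ Structure._◁_ N B D }
  }
  where
  ⊑⊕ : Structure.Carrier M × Structure.Carrier N → Structure.Carrier M × Structure.Carrier N → Set
  ⊑⊕ (A , B) (C , D) = Structure._⊑_ M A C × Structure._⊑_ N B D

{-# OPTIONS --safe #-}
module Submission where

-- An element of M ⊕ MSO(1), and likewise of MSO(n+1), is uniquely a set of the smaller
-- structure M, resp. MSO(n), together with one bit recording whether it contains the new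
-- atom, which lies above all old ones.  Every unnested atomic relation between such pairs
-- is an unnested atomic condition on the sets, decided by the bits.  Hence each unnested
-- sentence φ has a translation τφ of the same quantifier rank, independent of the
-- structures, with  M ⊕ MSO(1) ⊨ φ ⇔ M ⊨ τφ  and  MSO(n+1) ⊨ φ ⇔ MSO(n) ⊨ τφ.

open import Defs
open import Level using (0ℓ)
open import Axiom.ExcludedMiddle using (ExcludedMiddle)
open import Data.Bool using (Bool; true; false; if_then_else_; not; _∧_; _xor_; _≤_; f≤t; b≤b)
open import Data.Nat using (ℕ; zero; suc; _⊔_)
import Data.Nat as ℕ
open import Data.Nat.Properties using (⊔-idem; <⇒≱)
open import Data.Fin using (Fin; zero; suc; inject₁; fromℕ; _<_)
open import Data.Fin.Properties using (toℕ-inject₁; toℕ-fromℕ; toℕ<n; ≤fromℕ)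
open import Data.Fin.Relation.Unary.Top using (view; ‵fromℕ; ‵inject₁)
open import Data.Fin.Subset as Subset using (Subset; _∈_; _⊆_; ⁅_⁆)
open import Data.Fin.Subset.Properties using (nonempty?; Empty-unique; ∉⊥)
open import Data.Vec using (Vec; []; _∷_; _∷ʳ_; _[_]=_; here; there; initLast)
open import Data.Vec.Properties using (∷ʳ-injective)
open import Data.Product using (Σ; ∃₂; _×_; _,_; proj₁; proj₂)
open import Data.Product.Function.NonDependent.Propositional using (_×-⇔_)
open import Data.Sum as Sum using (_⊎_; inj₁; inj₂)
open import Data.Sum.Function.Propositional using (_⊎-⇔_)
open import Data.Empty using (⊥-elim)
open import Function using (_∘_; case_of_)
open import Function.Bundles using (_⇔_; mk⇔; module Equivalence)
open import Function.Construct.Identity using (⇔-id)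
open import Function.Related.TypeIsomorphisms using (¬-cong-⇔; →-cong-⇔)
open import Relation.Nullary using (¬_; yes; no)
open import Relation.Binary.PropositionalEquality
open import Relation.Binary.Lattice.Structures using (module IsBooleanAlgebra)
open import Relation.Binary.Structures using (IsPartialOrder)

open Equivalence using (to; from)

private
  variable
    n k : ℕ

if-preserves : ∀ {A : Set} (P : A → Set) b {x y : A} → P x → P y → P (if b then x else y)
if-preserves P true  Px Py = Px
if-preserves P false Px Py = Py

-- β i is the bit of variable i: whether it denotes a set containing the new atom.
translate : {φ : Formula n} → Unnested φ → (Fin n → Bool) → Formula n
translate (u-eq i j)  β = if β i xor β j then ⊥ᶠ else (var i ≐ var j)
translate (u-eqbot i) β = if β i then ⊥ᶠ else (var i ≐ botₜ)
translate (u-at i)    β = if β i then (var i ≐ botₜ) else Atᶠ (var i)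
translate (u-sub i j) β = if β i ∧ not (β j) then ⊥ᶠ else (var i ⊆ᶠ var j)
translate (u-lt i j)  β =
  if β j then (¬ᶠ (var i ≐ botₜ)) ∨ᶠ (var i ◁ᶠ var j) else (var i ◁ᶠ var j)
translate u-⊤         β = ⊤ᶠ
translate u-⊥         β = ⊥ᶠ
translate (u-¬ u)     β = ¬ᶠ translate u β
translate (u-∧ u v)   β = translate u β ∧ᶠ translate v β
translate (u-∨ u v)   β = translate u β ∨ᶠ translate v β
translate (u-⇒ u v)   β = translate u β ⇒ᶠ translate v β
translate (u-∀ u)     β = ∀ᶠ (translate u (false ∷ₑ β) ∧ᶠ translate u (true ∷ₑ β))
translate (u-∃ u)     β = ∃ᶠ (translate u (false ∷ₑ β) ∨ᶠ translate u (true ∷ₑ β))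

translate-unnested : {φ : Formula n} (u : Unnested φ) (β : Fin n → Bool) → Unnested (translate u β)
translate-unnested (u-eq i j)  β = if-preserves Unnested (β i xor β j) u-⊥ (u-eq i j)
translate-unnested (u-eqbot i) β = if-preserves Unnested (β i) u-⊥ (u-eqbot i)
translate-unnested (u-at i)    β = if-preserves Unnested (β i) (u-eqbot i) (u-at i)
translate-unnested (u-sub i j) β = if-preserves Unnested (β i ∧ not (β j)) u-⊥ (u-sub i j)
translate-unnested (u-lt i j)  β =
  if-preserves Unnested (β j) (u-∨ (u-¬ (u-eqbot i)) (u-lt i j)) (u-lt i j)
translate-unnested u-⊤         β = u-⊤
translate-unnested u-⊥         β = u-⊥
translate-unnested (u-¬ u)     β = u-¬ (translate-unnested u β)
translate-unnested (u-∧ u v)   β = u-∧ (translate-unnested u β) (translate-unnested v β)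
translate-unnested (u-∨ u v)   β = u-∨ (translate-unnested u β) (translate-unnested v β)
translate-unnested (u-⇒ u v)   β = u-⇒ (translate-unnested u β) (translate-unnested v β)
translate-unnested (u-∀ u)     β = u-∀ (u-∧ (translate-unnested u _) (translate-unnested u _))
translate-unnested (u-∃ u)     β = u-∃ (u-∨ (translate-unnested u _) (translate-unnested u _))

QuantifierFree : Formula n → Set
QuantifierFree ψ = qr ψ ≡ 0

translate-qr : {φ : Formula n} (u : Unnested φ) (β : Fin n → Bool) → qr (translate u β) ≡ qr φ
translate-qr (u-eq i j)  β = if-preserves QuantifierFree (β i xor β j) refl refl
translate-qr (u-eqbot i) β = if-preserves QuantifierFree (β i) refl refl
translate-qr (u-at i)    β = if-preserves QuantifierFree (β i) refl refl
translate-qr (u-sub i j) β = if-preserves QuantifierFree (β i ∧ not (β j)) refl refl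
translate-qr (u-lt i j)  β = if-preserves QuantifierFree (β j) refl refl
translate-qr u-⊤         β = refl
translate-qr u-⊥         β = refl
translate-qr (u-¬ u)     β = translate-qr u β
translate-qr (u-∧ u v)   β = cong₂ _⊔_ (translate-qr u β) (translate-qr v β)
translate-qr (u-∨ u v)   β = cong₂ _⊔_ (translate-qr u β) (translate-qr v β)
translate-qr (u-⇒ u v)   β = cong₂ _⊔_ (translate-qr u β) (translate-qr v β)
translate-qr (u-∀ u)     β =
  cong suc (trans (cong₂ _⊔_ (translate-qr u _) (translate-qr u _)) (⊔-idem _))
translate-qr (u-∃ u)     β =
  cong suc (trans (cong₂ _⊔_ (translate-qr u _) (translate-qr u _)) (⊔-idem _))

-- P is M with one new atom added above all atoms of M; adjoin a b is the set a,
-- enlarged by the new atom when b is true.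
record OnePointExtension (P M : Structure) : Set where
  private
    module P = Structure P
    module M = Structure M
  field
    adjoin            : M.Carrier → Bool → P.Carrier
    adjoin-surjective : ∀ p → ∃₂ λ a b → p ≡ adjoin a b
    adjoin-injective  : ∀ {a b c d} → adjoin a b ≡ adjoin c d → a ≡ c × b ≡ d
    adjoin-bot        : adjoin M.bot false ≡ P.bot
    At-adjoin-true⇔   : ∀ a → P.At (adjoin a true) ⇔ (a ≡ M.bot)
    At-adjoin-false⇔  : ∀ a → P.At (adjoin a false) ⇔ M.At a
    adjoin-⊑⇔         : ∀ {b d} a c → b ≤ d → (adjoin a b P.⊑ adjoin c d) ⇔ (a M.⊑ c)
    adjoin-true⋢false : ∀ a c → ¬ (adjoin a true P.⊑ adjoin c false)
    adjoin-◁-true⇔    : ∀ a b c → (adjoin a b P.◁ adjoin c true) ⇔ (a ≢ M.bot ⊎ a M.◁ c)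
    adjoin-◁-false⇔   : ∀ a b c → (adjoin a b P.◁ adjoin c false) ⇔ (a M.◁ c)

module _ {P M : Structure} (E : OnePointExtension P M) where
  open OnePointExtension E
  private
    module P = Structure P
    module M = Structure M

  adjoin-≡⇔ : ∀ {a c} b → (adjoin a b ≡ adjoin c b) ⇔ (a ≡ c)
  adjoin-≡⇔ b = mk⇔ (proj₁ ∘ adjoin-injective) (cong (λ x → adjoin x b))

  adjoin-≢ : ∀ {a b c d} → b ≢ d → adjoin a b ≢ adjoin c d
  adjoin-≢ b≢d = b≢d ∘ proj₂ ∘ adjoin-injective

  adjoin-false≡bot⇔ : ∀ a → (adjoin a false ≡ P.bot) ⇔ (a ≡ M.bot)
  adjoin-false≡bot⇔ a = mk⇔ (λ e → to (adjoin-≡⇔ false) (trans e (sym adjoin-bot)))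
                            (λ e → trans (cong (λ x → adjoin x false) e) adjoin-bot)

  adjoin-true≢bot : ∀ a → adjoin a true ≢ P.bot
  adjoin-true≢bot a e = adjoin-≢ (λ ()) (trans e (sym adjoin-bot))

  ∀-adjoin⇔ : {S : P.Carrier → Set} {T : M.Carrier → Bool → Set} →
              (∀ a b → S (adjoin a b) ⇔ T a b) →
              (∀ p → S p) ⇔ (∀ a → T a false × T a true)
  ∀-adjoin⇔ {S} {T} S⇔T = mk⇔ (λ s a → to (S⇔T a false) (s _) , to (S⇔T a true) (s _)) back
    where
    back : (∀ a → T a false × T a true) → ∀ p → S p
    back t p with adjoin-surjective p
    ... | a , false , refl = from (S⇔T a false) (proj₁ (t a))
    ... | a , true  , refl = from (S⇔T a true) (proj₂ (t a))

  ∃-adjoin⇔ : {S : P.Carrier → Set} {T : M.Carrier → Bool → Set} →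
              (∀ a b → S (adjoin a b) ⇔ T a b) →
              Σ P.Carrier S ⇔ Σ M.Carrier (λ a → T a false ⊎ T a true)
  ∃-adjoin⇔ {S} {T} S⇔T = mk⇔ forth back
    where
    forth : Σ P.Carrier S → Σ M.Carrier (λ a → T a false ⊎ T a true)
    forth (p , s) with adjoin-surjective p
    ... | a , false , refl = a , inj₁ (to (S⇔T a false) s)
    ... | a , true  , refl = a , inj₂ (to (S⇔T a true) s)
    back : Σ M.Carrier (λ a → T a false ⊎ T a true) → Σ P.Carrier S
    back (a , inj₁ t) = adjoin a false , from (S⇔T a false) t
    back (a , inj₂ t) = adjoin a true , from (S⇔T a true) t

  Represents : (Fin n → P.Carrier) → (Fin n → M.Carrier) → (Fin n → Bool) → Set
  Represents ρP ρM β = ∀ i → ρP i ≡ adjoin (ρM i) (β i)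

  represents-∷ : ∀ {ρP ρM β} {a : M.Carrier} {b : Bool} → Represents {n} ρP ρM β →
                 Represents (adjoin a b ∷ₑ ρP) (a ∷ₑ ρM) (b ∷ₑ β)
  represents-∷ h zero    = refl
  represents-∷ h (suc i) = h i

  Sat-translate : ∀ {φ : Formula n} {ρP ρM β} (u : Unnested φ) → Represents ρP ρM β →
                  Sat P φ ρP ⇔ Sat M (translate u β) ρM
  Sat-translate {β = β} (u-eq i j) h rewrite h i | h j with β i | β j
  ... | false | false = adjoin-≡⇔ false
  ... | false | true  = mk⇔ (adjoin-≢ λ ()) λ ()
  ... | true  | false = mk⇔ (adjoin-≢ λ ()) λ ()
  ... | true  | true  = adjoin-≡⇔ true
  Sat-translate {β = β} (u-eqbot i) h rewrite h i with β i
  ... | false = adjoin-false≡bot⇔ _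
  ... | true  = mk⇔ (adjoin-true≢bot _) λ ()
  Sat-translate {β = β} (u-at i) h rewrite h i with β i
  ... | false = At-adjoin-false⇔ _
  ... | true  = At-adjoin-true⇔ _
  Sat-translate {β = β} (u-sub i j) h rewrite h i | h j with β i | β j
  ... | false | false = adjoin-⊑⇔ _ _ b≤b
  ... | false | true  = adjoin-⊑⇔ _ _ f≤t
  ... | true  | false = mk⇔ (adjoin-true⋢false _ _) λ ()
  ... | true  | true  = adjoin-⊑⇔ _ _ b≤b
  Sat-translate {β = β} (u-lt i j) h rewrite h i | h j with β j
  ... | false = adjoin-◁-false⇔ _ _ _
  ... | true  = adjoin-◁-true⇔ _ _ _
  Sat-translate u-⊤       h = ⇔-id _
  Sat-translate u-⊥       h = ⇔-id _
  Sat-translate (u-¬ u)   h = ¬-cong-⇔ (Sat-translate u h)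
  Sat-translate (u-∧ u v) h = Sat-translate u h ×-⇔ Sat-translate v h
  Sat-translate (u-∨ u v) h = Sat-translate u h ⊎-⇔ Sat-translate v h
  Sat-translate (u-⇒ u v) h = →-cong-⇔ (Sat-translate u h) (Sat-translate v h)
  Sat-translate (u-∀ u)   h = ∀-adjoin⇔ λ _ _ → Sat-translate u (represents-∷ h)
  Sat-translate (u-∃ u)   h = ∃-adjoin⇔ λ _ _ → Sat-translate u (represents-∷ h)

  ⊨-translate : {φ : Sentence} (u : Unnested φ) → (P ⊨ φ) ⇔ (M ⊨ translate u empty)
  ⊨-translate u = Sat-translate u λ ()

≈-extension : ∀ {P M P′ M′} → OnePointExtension P M → OnePointExtension P′ M′ →
              M ≈[ k ] M′ → P ≈[ k ] P′
≈-extension {k = k} E E′ M≈M′ φ u qr≤k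
  with M≈M′ (translate u empty) (translate-unnested u empty)
            (subst (ℕ._≤ k) (sym (translate-qr u empty)) qr≤k)
... | M⇒M′ , M′⇒M = from (⊨-translate E′ u) ∘ M⇒M′ ∘ to (⊨-translate E u)
                  , from (⊨-translate E u) ∘ M′⇒M ∘ to (⊨-translate E′ u)

¬◁-MSO1 : ∀ X Y → ¬ Structure._◁_ (MSO 1) X Y
¬◁-MSO1 X Y (zero , zero , _ , _ , ())

⊆-MSO1 : ∀ {b d} → b ≤ d → (b ∷ []) ⊆ (d ∷ [])
⊆-MSO1 b≤b x∈b = x∈b
⊆-MSO1 f≤t (there ())

module _ {M : Structure} (T : ModelsTbase M) where
  open Structure M
  open ModelsTbase T
  private
    module P = Structure (M ⊕ MSO 1)

  ⊑-isPartialOrder : IsPartialOrder _≡_ _⊑_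
  ⊑-isPartialOrder = IsBooleanAlgebra.isPartialOrder (proj₂ (proj₂ (proj₂ (proj₂ booleanOrder))))

  open IsPartialOrder ⊑-isPartialOrder using (antisym) renaming (refl to ⊑-refl)

  ⊑bot⇒≡bot : ∀ a → a ⊑ bot → a ≡ bot
  ⊑bot⇒≡bot a a⊑bot = antisym a⊑bot (botLeast a)

  adjoin-MSO1 : Carrier → Bool → P.Carrier
  adjoin-MSO1 a b = a , b ∷ []

  At-adjoin-MSO1-true⇔ : ∀ a → P.At (adjoin-MSO1 a true) ⇔ (a ≡ bot)
  At-adjoin-MSO1-true⇔ a = mk⇔ forth back
    where
    forth : P.At (adjoin-MSO1 a true) → a ≡ bot
    forth (_ , minimal) with minimal (a , false ∷ []) (⊑-refl , ⊆-MSO1 f≤t)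
    ... | inj₁ refl = refl
    back : a ≡ bot → P.At (adjoin-MSO1 a true)
    back refl = (λ ()) , below
      where
      below : ∀ Y → Y P.⊑ adjoin-MSO1 bot true → Y ≡ P.bot ⊎ Y ≡ adjoin-MSO1 bot true
      below (Y , false ∷ []) (Y⊑bot , _) rewrite ⊑bot⇒≡bot Y Y⊑bot = inj₁ refl
      below (Y , true ∷ [])  (Y⊑bot , _) rewrite ⊑bot⇒≡bot Y Y⊑bot = inj₂ refl

  At-adjoin-MSO1-false⇔ : ∀ a → P.At (adjoin-MSO1 a false) ⇔ At a
  At-adjoin-MSO1-false⇔ a = mk⇔ forth back
    where
    forth : P.At (adjoin-MSO1 a false) → At a
    forth (a≢bot , minimal) = proj₂ (atAtoms a) ((a≢bot ∘ cong (_, false ∷ [])) , below)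
      where
      below : ∀ y → y ⊑ a → y ≡ bot ⊎ y ≡ a
      below y y⊑a =
        Sum.map (cong proj₁) (cong proj₁) (minimal (y , false ∷ []) (y⊑a , ⊆-MSO1 b≤b))
    back : At a → P.At (adjoin-MSO1 a false)
    back at with proj₁ (atAtoms a) at
    ... | a≢bot , minimal = (a≢bot ∘ cong proj₁) , below
      where
      below : ∀ Y → Y P.⊑ adjoin-MSO1 a false → Y ≡ P.bot ⊎ Y ≡ adjoin-MSO1 a false
      below (Y , false ∷ []) (Y⊑a , _) =
        Sum.map (cong (_, false ∷ [])) (cong (_, false ∷ [])) (minimal Y Y⊑a)
      below (Y , true ∷ [])  (_ , new∈) = ⊥-elim (∉⊥ (new∈ here))

  adjoin-MSO1-◁-true⇔ : ∀ a b c →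
                        (adjoin-MSO1 a b P.◁ adjoin-MSO1 c true) ⇔ (a ≢ bot ⊎ a ◁ c)
  adjoin-MSO1-◁-true⇔ a b c = mk⇔ forth back
    where
    forth : adjoin-MSO1 a b P.◁ adjoin-MSO1 c true → a ≢ bot ⊎ a ◁ c
    forth (inj₁ (a≢bot , _))    = inj₁ a≢bot
    forth (inj₂ (inj₁ a◁c))     = inj₂ a◁c
    forth (inj₂ (inj₂ new◁new)) = ⊥-elim (¬◁-MSO1 _ _ new◁new)
    back : a ≢ bot ⊎ a ◁ c → adjoin-MSO1 a b P.◁ adjoin-MSO1 c true
    back (inj₁ a≢bot) = inj₁ (a≢bot , λ ())
    back (inj₂ a◁c)   = inj₂ (inj₁ a◁c)

  adjoin-MSO1-◁-false⇔ : ∀ a b c → (adjoin-MSO1 a b P.◁ adjoin-MSO1 c false) ⇔ (a ◁ c)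
  adjoin-MSO1-◁-false⇔ a b c = mk⇔ forth (inj₂ ∘ inj₁)
    where
    forth : adjoin-MSO1 a b P.◁ adjoin-MSO1 c false → a ◁ c
    forth (inj₁ (_ , nonempty)) = ⊥-elim (nonempty refl)
    forth (inj₂ (inj₁ a◁c))     = a◁c
    forth (inj₂ (inj₂ x◁new))   = ⊥-elim (¬◁-MSO1 _ _ x◁new)

  ⊕-MSO1-extension : OnePointExtension (M ⊕ MSO 1) M
  ⊕-MSO1-extension = record
    { adjoin            = adjoin-MSO1
    ; adjoin-surjective = λ { (a , b ∷ []) → a , b , refl }
    ; adjoin-injective  = λ { refl → refl , refl }
    ; adjoin-bot        = refl
    ; At-adjoin-true⇔   = At-adjoin-MSO1-true⇔
    ; At-adjoin-false⇔  = At-adjoin-MSO1-false⇔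
    ; adjoin-⊑⇔         = λ a c b≤d → mk⇔ proj₁ (λ a⊑c → a⊑c , λ {_} → ⊆-MSO1 b≤d)
    ; adjoin-true⋢false = λ { a c (_ , new∈) → ∉⊥ (new∈ here) }
    ; adjoin-◁-true⇔    = adjoin-MSO1-◁-true⇔
    ; adjoin-◁-false⇔   = adjoin-MSO1-◁-false⇔
    }

inject₁<inject₁⇔ : (i j : Fin n) → (inject₁ i < inject₁ j) ⇔ (i < j)
inject₁<inject₁⇔ i j rewrite toℕ-inject₁ i | toℕ-inject₁ j = ⇔-id _

inject₁<fromℕ : (i : Fin n) → inject₁ i < fromℕ n
inject₁<fromℕ {n} i rewrite toℕ-inject₁ i | toℕ-fromℕ n = toℕ<n i

fromℕ≮ : (x : Fin (suc n)) → ¬ (fromℕ n < x)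
fromℕ≮ x fromℕ<x = <⇒≱ fromℕ<x (≤fromℕ x)

∷ʳ-[inject₁]=⇔ : ∀ {A : Set} {x y : A} (xs : Vec A n) j →
                 ((xs ∷ʳ y) [ inject₁ j ]= x) ⇔ (xs [ j ]= x)
∷ʳ-[inject₁]=⇔ (_ ∷ xs) zero    = mk⇔ (λ { here → here }) (λ { here → here })
∷ʳ-[inject₁]=⇔ (_ ∷ xs) (suc j) =
  mk⇔ (λ { (there p) → there (to IH p) }) (λ { (there p) → there (from IH p) })
  where IH = ∷ʳ-[inject₁]=⇔ xs j

∷ʳ-[fromℕ]=⇔ : ∀ {A : Set} {x y : A} (xs : Vec A n) → ((xs ∷ʳ y) [ fromℕ n ]= x) ⇔ (y ≡ x)
∷ʳ-[fromℕ]=⇔ []       = mk⇔ (λ { here → refl }) (λ { refl → here })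
∷ʳ-[fromℕ]=⇔ (_ ∷ xs) = mk⇔ (λ { (there p) → to IH p }) (there ∘ from IH)
  where IH = ∷ʳ-[fromℕ]=⇔ xs

⊥-∷ʳ : ∀ n → Subset.⊥ {suc n} ≡ Subset.⊥ {n} ∷ʳ false
⊥-∷ʳ zero    = refl
⊥-∷ʳ (suc n) = cong (false ∷_) (⊥-∷ʳ n)

⁅inject₁⁆ : (j : Fin n) → ⁅ inject₁ j ⁆ ≡ ⁅ j ⁆ ∷ʳ false
⁅inject₁⁆ {suc n} zero    = cong (true ∷_) (⊥-∷ʳ n)
⁅inject₁⁆         (suc j) = cong (false ∷_) (⁅inject₁⁆ j)

⁅fromℕ⁆ : ∀ n → ⁅ fromℕ n ⁆ ≡ Subset.⊥ {n} ∷ʳ true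
⁅fromℕ⁆ zero    = refl
⁅fromℕ⁆ (suc n) = cong (false ∷_) (⁅fromℕ⁆ n)

≤-true : ∀ {b d} → b ≤ d → b ≡ true → d ≡ true
≤-true b≤b b≡true = b≡true
≤-true f≤t _      = refl

module _ (n : ℕ) where
  private
    module P = Structure (MSO (suc n))
    module M = Structure (MSO n)

  At-∷ʳ-true⇔ : ∀ a → P.At (a ∷ʳ true) ⇔ (a ≡ Subset.⊥)
  At-∷ʳ-true⇔ a = mk⇔ forth (λ { refl → fromℕ n , sym (⁅fromℕ⁆ n) })
    where
    forth : P.At (a ∷ʳ true) → a ≡ Subset.⊥
    forth (x , e) with view x
    ... | ‵fromℕ      = proj₁ (∷ʳ-injective _ _ (trans e (⁅fromℕ⁆ n)))
    ... | ‵inject₁ j with () ← proj₂ (∷ʳ-injective _ _ (trans e (⁅inject₁⁆ j)))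

  At-∷ʳ-false⇔ : ∀ a → P.At (a ∷ʳ false) ⇔ M.At a
  At-∷ʳ-false⇔ a = mk⇔ forth (λ { (j , refl) → inject₁ j , sym (⁅inject₁⁆ j) })
    where
    forth : P.At (a ∷ʳ false) → M.At a
    forth (x , e) with view x
    ... | ‵fromℕ      with () ← proj₂ (∷ʳ-injective _ _ (trans e (⁅fromℕ⁆ n)))
    ... | ‵inject₁ j = j , proj₁ (∷ʳ-injective _ _ (trans e (⁅inject₁⁆ j)))

  ∷ʳ-⊆⇔ : ∀ {b d} (a c : Subset n) → b ≤ d → (a ∷ʳ b ⊆ c ∷ʳ d) ⇔ (a ⊆ c)
  ∷ʳ-⊆⇔ {b} {d} a c b≤d = mk⇔ forth back
    where
    forth : a ∷ʳ b ⊆ c ∷ʳ d → a ⊆ c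
    forth s {j} = to (∷ʳ-[inject₁]=⇔ c j) ∘ s ∘ from (∷ʳ-[inject₁]=⇔ a j)
    back : a ⊆ c → a ∷ʳ b ⊆ c ∷ʳ d
    back s {x} x∈ with view x
    ... | ‵fromℕ     = from (∷ʳ-[fromℕ]=⇔ c) (≤-true b≤d (to (∷ʳ-[fromℕ]=⇔ a) x∈))
    ... | ‵inject₁ j = from (∷ʳ-[inject₁]=⇔ c j) (s (to (∷ʳ-[inject₁]=⇔ a j) x∈))

  ◁-∷ʳ⁺ : ∀ {a c} b d → a M.◁ c → (a ∷ʳ b) P.◁ (c ∷ʳ d)
  ◁-∷ʳ⁺ {a} {c} b d (i , j , i∈a , j∈c , i<j) =
    inject₁ i , inject₁ j , from (∷ʳ-[inject₁]=⇔ a i) i∈a , from (∷ʳ-[inject₁]=⇔ c j) j∈c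
              , from (inject₁<inject₁⇔ i j) i<j

  ◁-∷ʳ⁻ : ∀ {a b c d} i j → inject₁ i ∈ a ∷ʳ b → inject₁ j ∈ c ∷ʳ d →
          inject₁ i < inject₁ j → a M.◁ c
  ◁-∷ʳ⁻ {a} {b} {c} {d} i j i∈ j∈ i<j =
    i , j , to (∷ʳ-[inject₁]=⇔ a i) i∈ , to (∷ʳ-[inject₁]=⇔ c j) j∈ , to (inject₁<inject₁⇔ i j) i<j

  ∷ʳ-◁-true⇔ : ∀ a b c → ((a ∷ʳ b) P.◁ (c ∷ʳ true)) ⇔ (a ≢ Subset.⊥ ⊎ a M.◁ c)
  ∷ʳ-◁-true⇔ a b c = mk⇔ forth back
    where
    forth : (a ∷ʳ b) P.◁ (c ∷ʳ true) → a ≢ Subset.⊥ ⊎ a M.◁ c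
    forth (i , j , i∈ , j∈ , i<j) with view i | view j
    ... | ‵fromℕ      | _           = ⊥-elim (fromℕ≮ j i<j)
    ... | ‵inject₁ i′ | ‵fromℕ      =
      inj₁ (λ a≡⊥ → ∉⊥ (subst (i′ ∈_) a≡⊥ (to (∷ʳ-[inject₁]=⇔ a i′) i∈)))
    ... | ‵inject₁ i′ | ‵inject₁ j′ = inj₂ (◁-∷ʳ⁻ i′ j′ i∈ j∈ i<j)
    back : a ≢ Subset.⊥ ⊎ a M.◁ c → (a ∷ʳ b) P.◁ (c ∷ʳ true)
    back (inj₂ a◁c) = ◁-∷ʳ⁺ b true a◁c
    back (inj₁ a≢⊥) with nonempty? a
    ... | yes (i , i∈a) = inject₁ i , fromℕ n , from (∷ʳ-[inject₁]=⇔ a i) i∈a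
                                    , from (∷ʳ-[fromℕ]=⇔ c) refl , inject₁<fromℕ i
    ... | no a-empty    = ⊥-elim (a≢⊥ (Empty-unique a-empty))

  ∷ʳ-◁-false⇔ : ∀ a b c → ((a ∷ʳ b) P.◁ (c ∷ʳ false)) ⇔ (a M.◁ c)
  ∷ʳ-◁-false⇔ a b c = mk⇔ forth (◁-∷ʳ⁺ b false)
    where
    forth : (a ∷ʳ b) P.◁ (c ∷ʳ false) → a M.◁ c
    forth (i , j , i∈ , j∈ , i<j) with view i | view j
    ... | _           | ‵fromℕ      with () ← to (∷ʳ-[fromℕ]=⇔ c) j∈
    ... | ‵fromℕ      | ‵inject₁ j′ = ⊥-elim (fromℕ≮ _ i<j)
    ... | ‵inject₁ i′ | ‵inject₁ j′ = ◁-∷ʳ⁻ i′ j′ i∈ j∈ i<j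

  MSO-suc-extension : OnePointExtension (MSO (suc n)) (MSO n)
  MSO-suc-extension = record
    { adjoin            = _∷ʳ_
    ; adjoin-surjective = initLast
    ; adjoin-injective  = ∷ʳ-injective _ _
    ; adjoin-bot        = sym (⊥-∷ʳ n)
    ; At-adjoin-true⇔   = At-∷ʳ-true⇔
    ; At-adjoin-false⇔  = At-∷ʳ-false⇔
    ; adjoin-⊑⇔         = ∷ʳ-⊆⇔
    ; adjoin-true⋢false = λ a c s →
        case to (∷ʳ-[fromℕ]=⇔ c) (s (from (∷ʳ-[fromℕ]=⇔ a) refl)) of λ ()
    ; adjoin-◁-true⇔    = ∷ʳ-◁-true⇔
    ; adjoin-◁-false⇔   = ∷ʳ-◁-false⇔
    }

proposition3p9 : ExcludedMiddle 0ℓ → (M : Structure) → ModelsTMSOFin M →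
    (k n : ℕ) → M ≈[ k ] MSO n → (M ⊕ MSO 1) ≈[ k ] MSO (suc n)
proposition3p9 _ M M⊨T k n =
  ≈-extension (⊕-MSO1-extension (ModelsTMSOFin.base M⊨T)) (MSO-suc-extension n)
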